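{- Let $F$ be a CNF formula in which no literal occurs more than once, and suppose the stage algorithm fails at stage $i$. Let $l'$ be the first literal of clause $i$ and suppose $next^t(l')=l$ for some $t$. Then for every literal $l''$ in the same clause as $l$ there is $t'$ with $next^{t'}(l')=l''$.
   Context: $F=C_1\wedge\cdots\wedge C_m$, each clause a set of literals coded by natural numbers; $\overline l$ is the complement of $l$; the first literal of a clause is its literal with least code. A pure literal occurs in $F$ while its complement does not. $follows(l_1,l_2)$ holds if $l_1,l_2$ lie in the same clause and $l_1$ is the cyclic successor of $l_2$ in that clause w.r.t. the numerical order of codes (a single literal follows itself). For non-pure $l$, $next(l)$ is the literal following $\overline l$; for pure $l$, $next(l)=l$; $next^0(l)=l$, $next^{t+1}=next\circ next^t$. The algorithm processes stages $i=1,\dots,m$ in order, maintaining a (partial) truth assignment, where "assign true to $l$" sets the variable of $l$ so that $l$ is true (overriding earlier values). Stage $i$: set $l_1$ to the first literal of clause $i$; repeat: \{assign true to $l_1$; set $l_2:=next(l_1)$; while $l_2\ne\overline{l_1}$: \{assign true to $l_2$; set $l_2:=next(l_2)$; if $l_2$ is a pure literal, assign true to $l_2$ and stage $i$ is done; if $l_1$ and $l_2$ are in the same clause, stage $i$ is done\}; assign true to $l_1$; set $l_1:=next(l_1)$\} until $l_1$ is the first literal in clause $i$. If this repeat loop terminates (without stage $i$ being done), the algorithm fails at stage $i$. -}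

module Defs where

open import Data.Nat using (ℕ; zero; suc; _≡ᵇ_; _<ᵇ_; _⊔_; _⊓_; _<_)
open import Data.Bool using (Bool; true; false; if_then_else_; _∧_; not)
open import Data.List using (List; []; _∷_; filterᵇ; concat; length; lookup)
open import Data.Bool.ListAction using (any)
open import Data.Fin using (Fin; toℕ)
open import Data.Maybe using (Maybe; just; nothing)
open import Data.Product using (∃; _×_)
open import Relation.Binary.PropositionalEquality using (_≡_)

-- Literals are natural numbers.  Convention: the variable v has the two
-- literals 2v and 2v+1, which are complements of each other.
Literal : Set
Literal = ℕ

compl : Literal → Literal
compl zero          = 1
compl (suc zero)    = 0
compl (suc (suc n)) = suc (suc (compl n))

-- A clause is a list of literals, a formula is the list of its clauses
-- C_1 , … , C_m (clause i of the paper is  lookup F i).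
Clause : Set
Clause = List Literal

CNF : Set
CNF = List Clause

_∈ᵇ_ : Literal → Clause → Bool
l ∈ᵇ c = any (l ≡ᵇ_) c

minimum : List ℕ → Maybe ℕ
minimum []       = nothing
minimum (x ∷ xs) with minimum xs
... | nothing = just x
... | just y  = just (x ⊓ y)

first : Clause → Maybe Literal
first = minimum

occurs : CNF → Literal → Bool
occurs F l = any (l ∈ᵇ_) F

pure : CNF → Literal → Bool
pure F l = occurs F l ∧ not (occurs F (compl l))

sameClause : CNF → Literal → Literal → Bool
sameClause F l₁ l₂ = any (λ c → l₁ ∈ᵇ c ∧ l₂ ∈ᵇ c) F

-- Fallback l if c is empty.
cycSucc : Clause → Literal → Literal
cycSucc c l with minimum (filterᵇ (λ x → l <ᵇ x) c)
... | just y  = y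
... | nothing with minimum c
...   | just y  = y
...   | nothing = l

clauseOf : CNF → Literal → Maybe Clause
clauseOf []      l = nothing
clauseOf (c ∷ F) l = if l ∈ᵇ c then just c else clauseOf F l

-- next(l): for pure l, l itself; otherwise the literal following compl l
-- (in the clause containing compl l; when no literal occurs twice this clause
-- is unique).  If compl l does not occur at all (only possible when l does not
-- occur either; never reached by the algorithm), we return l.
next : CNF → Literal → Literal
next F l with pure F l
... | true  = l
... | false with clauseOf F (compl l)
...   | just c  = cycSucc c (compl l)
...   | nothing = l

next^ : CNF → ℕ → Literal → Literal
next^ F zero    l = l
next^ F (suc t) l = next F (next^ F t l)

-- Fuel-based execution of one stage of the algorithm.  The truth assignment
-- never influences the control flow, so it is omitted.
data Outcome : Set where
  done    : Outcome
  fail    : Outcome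
  timeout : Outcome   -- ran out of fuel (or stage undefined: empty clause)

data WhileResult : Set where
  wDone    : WhileResult
  wExit    : WhileResult
  wTimeout : WhileResult

whileLoop : CNF → ℕ → Literal → Literal → WhileResult
whileLoop F zero    l₁ l₂ = wTimeout
whileLoop F (suc k) l₁ l₂ =
  if l₂ ≡ᵇ compl l₁ then wExit
  else (if pure F (next F l₂) then wDone
  else (if sameClause F l₁ (next F l₂) then wDone
  else whileLoop F k l₁ (next F l₂)))

repeatLoop : CNF → ℕ → Literal → Literal → Outcome
repeatLoop F zero    fst l₁ = timeout
repeatLoop F (suc k) fst l₁ with whileLoop F k l₁ (next F l₁)
... | wDone    = done
... | wTimeout = timeout
... | wExit    = if next F l₁ ≡ᵇ fst then fail else repeatLoop F k fst (next F l₁)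

runStage : CNF → Clause → ℕ → Outcome
runStage F C fuel with first C
... | just l' = repeatLoop F fuel l' l'
... | nothing = timeout

StageDone : (F : CNF) → Fin (length F) → Set
StageDone F i = ∃ λ fuel → runStage F (lookup F i) fuel ≡ done

StageFails : (F : CNF) → Fin (length F) → Set
StageFails F i = ∃ λ fuel → runStage F (lookup F i) fuel ≡ fail

AlgorithmFailsAt : (F : CNF) → Fin (length F) → Set
AlgorithmFailsAt F i =
  ((j : Fin (length F)) → toℕ j < toℕ i → StageDone F j) × StageFails F i

-- Proof.  (1) Reading the loops of Defs backwards, a failing stage means the
-- repeat loop walks around a cycle l', next l', …, next^j l', next^{j+1} l' = l',
-- and at every point x of it the while loop exits normally, i.e. the orbit of
-- x passes through compl x.  So every literal on the orbit of l' reaches its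
-- complement, and the orbit is closed under complementation.
-- (2) Since no literal occurs twice, for x in clause c the complement compl x
-- is not pure and c is its clause, so next(compl x) is the cyclic successor of
-- x in c.  Hence the orbit is closed under the cyclic successor in c.
-- (3) A set closed under the cyclic successor of c meeting c contains c
-- (climb to the largest literal, wrap to the least one, climb again).

module Submission where

open import Defs
open import Data.Nat using (ℕ)
open import Data.Fin using (Fin)
open import Data.List using (List; concat; length; lookup)
open import Data.List.Relation.Unary.Unique.Propositional using (Unique)
open import Data.List.Relation.Unary.Any using (Any)
open import Data.List.Membership.Propositional using (_∈_)
open import Data.Maybe using (just)
open import Data.Product using (∃; _×_)
open import Relation.Binary.PropositionalEquality using (_≡_)

open import Data.Nat using (zero; suc; _+_; _≤_; _<_; _∸_; _⊓_; _≡ᵇ_; _<ᵇ_; z≤n)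
open import Data.Nat.Properties
  using (≡ᵇ⇒≡; ≡⇒≡ᵇ; <ᵇ⇒<; <⇒<ᵇ; ≤-refl; ≤-pred; ≤-trans; <⇒≱;
         m≤n⇒m<n∨m≡n; m<n⇒0<n∸m; ∸-monoʳ-<; m⊓n≤m; m⊓n≤n; ⊓-sel)
open import Data.Bool using (true; false; T; T?)
open import Data.Bool.Properties using (T-≡; ∧-zeroʳ)
open import Data.List using ([]; _∷_; _++_; filterᵇ)
open import Data.List.Relation.Unary.Any as Any using (here; there)
open import Data.List.Relation.Unary.Any.Properties using (any⁺; any⁻)
open import Data.List.Relation.Unary.AllPairs using (_∷_)
import Data.List.Relation.Unary.All as All
open import Data.List.Membership.Propositional using (_∉_; find)
open import Data.List.Membership.Propositional.Properties
  using (∈-++⁺ʳ; ∈-concat⁺′; ∈-filter⁺; ∈-filter⁻)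
open import Data.List.Extrema.Nat using (max; ⊥≤max; xs≤max; argmax-sel)
open import Data.Maybe using (nothing)
open import Data.Product using (_,_; proj₁; proj₂)
open import Data.Sum using (_⊎_; inj₁; inj₂)
open import Data.Empty using (⊥-elim)
open import Function.Base using (id)
open import Function.Bundles using (Equivalence)
open import Relation.Binary.PropositionalEquality using (refl; sym; trans; cong; subst)

compl-involutive : ∀ l → compl (compl l) ≡ l
compl-involutive zero          = refl
compl-involutive (suc zero)    = refl
compl-involutive (suc (suc l)) = cong (λ k → suc (suc k)) (compl-involutive l)

∈ᵇ-complete : ∀ {l c} → l ∈ c → T (l ∈ᵇ c)
∈ᵇ-complete {l} l∈c = any⁺ (l ≡ᵇ_) (Any.map (≡⇒≡ᵇ l _) l∈c)

∈ᵇ-sound : ∀ {l} c → T (l ∈ᵇ c) → l ∈ c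
∈ᵇ-sound {l} c h = Any.map (≡ᵇ⇒≡ l _) (any⁻ _ c h)

occurs-complete : ∀ {F c l} → c ∈ F → l ∈ c → T (occurs F l)
occurs-complete {l = l} c∈F l∈c = any⁺ (l ∈ᵇ_) (Any.map (λ { refl → ∈ᵇ-complete l∈c }) c∈F)

unique-++ʳ : ∀ (xs : List ℕ) {ys} → Unique (xs ++ ys) → Unique ys
unique-++ʳ []       u       = u
unique-++ʳ (x ∷ xs) (_ ∷ u) = unique-++ʳ xs u

unique-++-disjoint : ∀ (xs : List ℕ) {ys x} → Unique (xs ++ ys) → x ∈ xs → x ∉ ys
unique-++-disjoint (a ∷ xs) (a∉ ∷ u) (here refl) x∈ys = All.lookup a∉ (∈-++⁺ʳ xs x∈ys) refl
unique-++-disjoint (a ∷ xs) (_ ∷ u)  (there x∈xs) x∈ys = unique-++-disjoint xs u x∈xs x∈ys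

clauseOf-unique : ∀ {F c l} → Unique (concat F) → c ∈ F → l ∈ c → clauseOf F l ≡ just c
clauseOf-unique {c ∷ F} {l = l} u (here refl) l∈c
  rewrite Equivalence.to T-≡ (∈ᵇ-complete {l} {c} l∈c) = refl
clauseOf-unique {c' ∷ F} {l = l} u (there c∈F) l∈c with l ∈ᵇ c' in e
... | true  = ⊥-elim (unique-++-disjoint c' u (∈ᵇ-sound c' (Equivalence.from T-≡ e))
                                              (∈-concat⁺′ l∈c c∈F))
... | false = clauseOf-unique (unique-++ʳ c' u) c∈F l∈c

compl-not-pure : ∀ {F c x} → c ∈ F → x ∈ c → pure F (compl x) ≡ false
compl-not-pure {F} {c} {x} c∈F x∈c
  rewrite compl-involutive x | Equivalence.to T-≡ (occurs-complete {F} c∈F x∈c) =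
  ∧-zeroʳ (occurs F (compl x))

-- Key local fact: for a literal x of clause c, next(compl x) is the cyclic
-- successor of x in c (compl x is not pure and c is the clause of x).
next-compl : ∀ {F c x} → Unique (concat F) → c ∈ F → x ∈ c → next F (compl x) ≡ cycSucc c x
next-compl {F} {c} {x} u c∈F x∈c with pure F (compl x) | compl-not-pure {F} c∈F x∈c
... | false | refl with clauseOf F (compl (compl x)) | clauseOf-compl-compl
  where
  clauseOf-compl-compl : clauseOf F (compl (compl x)) ≡ just c
  clauseOf-compl-compl rewrite compl-involutive x = clauseOf-unique u c∈F x∈c
...   | just .c | refl = cong (cycSucc c) (compl-involutive x)

minimum-exists : ∀ {x} (xs : List ℕ) → x ∈ xs → ∃ λ m → minimum xs ≡ just m
minimum-exists (y ∷ xs) _ with minimum xs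
... | nothing = y , refl
... | just z  = y ⊓ z , refl

minimum-nothing : ∀ (xs : List ℕ) {z} → minimum xs ≡ nothing → z ∉ xs
minimum-nothing xs e z∈xs with minimum-exists xs z∈xs
... | m , e′ with trans (sym e) e′
... | ()

minimum-just : ∀ (xs : List ℕ) {m} → minimum xs ≡ just m → m ∈ xs × (∀ {z} → z ∈ xs → m ≤ z)
minimum-just (x ∷ xs) eq with minimum xs in e
minimum-just (x ∷ xs) refl | nothing =
  here refl , λ { (here refl) → ≤-refl ; (there z∈xs) → ⊥-elim (minimum-nothing xs e z∈xs) }
minimum-just (x ∷ xs) refl | just y with minimum-just xs e
... | y∈xs , y≤ = member (⊓-sel x y) , lower
  where
  member : (x ⊓ y ≡ x) ⊎ (x ⊓ y ≡ y) → x ⊓ y ∈ x ∷ xs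
  member (inj₁ eq) = here eq
  member (inj₂ eq) = there (subst (_∈ xs) (sym eq) y∈xs)
  lower : ∀ {z} → z ∈ x ∷ xs → x ⊓ y ≤ z
  lower (here refl)  = m⊓n≤m x y
  lower (there z∈xs) = ≤-trans (m⊓n≤n x y) (y≤ z∈xs)

∈-above⁺ : ∀ {x z} c → z ∈ c → x < z → z ∈ filterᵇ (x <ᵇ_) c
∈-above⁺ {x} c z∈c x<z = ∈-filter⁺ (λ y → T? (x <ᵇ y)) z∈c (<⇒<ᵇ x<z)

∈-above⁻ : ∀ {x s} c → s ∈ filterᵇ (x <ᵇ_) c → s ∈ c × x < s
∈-above⁻ {x} {s} c s∈ with ∈-filter⁻ (λ y → T? (x <ᵇ y)) {xs = c} s∈
... | s∈c , x<ᵇs = s∈c , <ᵇ⇒< x s x<ᵇs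

cycSucc-above : ∀ {c x z} → z ∈ c → x < z →
  cycSucc c x ∈ c × x < cycSucc c x × cycSucc c x ≤ z
cycSucc-above {c} {x} z∈c x<z with minimum (filterᵇ (x <ᵇ_) c) in e
... | just s  = let s∈c , x<s = ∈-above⁻ c (proj₁ (minimum-just _ e))
                in s∈c , x<s , proj₂ (minimum-just _ e) (∈-above⁺ c z∈c x<z)
... | nothing = ⊥-elim (minimum-nothing _ e (∈-above⁺ c z∈c x<z))

cycSucc-wrap : ∀ {c x m} → (∀ {z} → z ∈ c → z ≤ x) → minimum c ≡ just m → cycSucc c x ≡ m
cycSucc-wrap {c} {x} x-max em with minimum (filterᵇ (x <ᵇ_) c) in e
... | just s  = let s∈c , x<s = ∈-above⁻ c (proj₁ (minimum-just _ e))
                in ⊥-elim (<⇒≱ x<s (x-max s∈c))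
... | nothing rewrite em = refl

-- From x we climb to the largest literal, wrap around to the least one, and
-- climb again to any target.
module CyclicClosure (c : Clause) (P : Literal → Set)
  (closed : ∀ {x} → x ∈ c → P x → P (cycSucc c x)) where

  climb : ∀ d {x y} → y ∸ x ≤ d → x ∈ c → y ∈ c → x ≤ y → P x → P y
  climb d gap x∈c y∈c x≤y px with m≤n⇒m<n∨m≡n x≤y
  ... | inj₂ refl = px
  climb zero    gap x∈c y∈c x≤y px | inj₁ x<y = ⊥-elim (<⇒≱ (m<n⇒0<n∸m x<y) gap)
  climb (suc d) gap x∈c y∈c x≤y px | inj₁ x<y with cycSucc-above y∈c x<y
  ... | s∈c , x<s , s≤y =
    climb d (≤-pred (≤-trans (∸-monoʳ-< x<s s≤y) gap)) s∈c y∈c s≤y (closed x∈c px)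

  covers : ∀ {x y} → x ∈ c → y ∈ c → P x → P y
  covers {x} {y} x∈c y∈c px = climb (y ∸ least) ≤-refl least∈c y∈c (least≤ y∈c) p-least
    where
    top : Literal
    top = max x c

    top∈c : top ∈ c
    top∈c with argmax-sel id x c
    ... | inj₁ top≡x = subst (_∈ c) (sym top≡x) x∈c
    ... | inj₂ top∈  = top∈

    p-top : P top
    p-top = climb (top ∸ x) ≤-refl x∈c top∈c (⊥≤max x c) px

    least : Literal
    least = proj₁ (minimum-exists c x∈c)

    least-eq : minimum c ≡ just least
    least-eq = proj₂ (minimum-exists c x∈c)

    least∈c : least ∈ c
    least∈c = proj₁ (minimum-just c least-eq)

    least≤ : ∀ {z} → z ∈ c → least ≤ z
    least≤ = proj₂ (minimum-just c least-eq)

    p-least : P least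
    p-least = subst P (cycSucc-wrap (All.lookup (xs≤max x c)) least-eq) (closed top∈c p-top)

module Dynamics (F : CNF) where

  next^-next : ∀ t x → next^ F t (next F x) ≡ next F (next^ F t x)
  next^-next zero    x = refl
  next^-next (suc t) x = cong (next F) (next^-next t x)

  next^-+ : ∀ s t x → next^ F s (next^ F t x) ≡ next^ F (s + t) x
  next^-+ zero    t x = refl
  next^-+ (suc s) t x = cong (next F) (next^-+ s t x)

  OnOrbit : Literal → Literal → Set
  OnOrbit l x = ∃ λ t → next^ F t l ≡ x

  ReachesCompl : Literal → Set
  ReachesCompl x = ∃ λ s → next^ F s x ≡ compl x

  whileExit⇒reaches : ∀ k l₁ l₂ → whileLoop F k l₁ l₂ ≡ wExit → OnOrbit l₂ (compl l₁)
  whileExit⇒reaches (suc k) l₁ l₂ h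
    with l₂ ≡ᵇ compl l₁ in at-compl | pure F (next F l₂) | sameClause F l₁ (next F l₂)
  ... | true  | _     | _     = zero , ≡ᵇ⇒≡ l₂ (compl l₁) (Equivalence.from T-≡ at-compl)
  ... | false | false | false with whileExit⇒reaches k l₁ (next F l₂) h
  ...   | s , reach = suc s , trans (sym (next^-next s l₂)) reach
  whileExit⇒reaches (suc k) l₁ l₂ () | false | true  | _
  whileExit⇒reaches (suc k) l₁ l₂ () | false | false | true

  roundExit⇒reachesCompl : ∀ k l₁ → whileLoop F k l₁ (next F l₁) ≡ wExit → ReachesCompl l₁
  roundExit⇒reachesCompl k l₁ h with whileExit⇒reaches k l₁ (next F l₁) h
  ... | s , reach = suc s , trans (sym (next^-next s l₁)) reach

  repeatFail⇒cycle : ∀ k fst l₁ → repeatLoop F k fst l₁ ≡ fail →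
    ∃ λ j → next^ F (suc j) l₁ ≡ fst × (∀ b → b ≤ j → ReachesCompl (next^ F b l₁))
  repeatFail⇒cycle (suc k) fst l₁ h with whileLoop F k l₁ (next F l₁) in exit
  repeatFail⇒cycle (suc k) fst l₁ () | wDone
  repeatFail⇒cycle (suc k) fst l₁ () | wTimeout
  ... | wExit with next F l₁ ≡ᵇ fst in back
  ...   | true  = zero , ≡ᵇ⇒≡ _ _ (Equivalence.from T-≡ back) ,
                  λ { zero _ → roundExit⇒reachesCompl k l₁ exit }
  ...   | false with repeatFail⇒cycle k fst (next F l₁) h
  ...     | j , returns , reaching = suc j , trans (sym (next^-next (suc j) l₁)) returns , reaching′
    where
    reaching′ : ∀ b → b ≤ suc j → ReachesCompl (next^ F b l₁)
    reaching′ zero    _   = roundExit⇒reachesCompl k l₁ exit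
    reaching′ (suc b) b≤j = subst ReachesCompl (next^-next b l₁) (reaching b (≤-pred b≤j))

  periodic : ∀ j l → next^ F (suc j) l ≡ l → ∀ t → ∃ λ b → b ≤ j × next^ F t l ≡ next^ F b l
  periodic j l cycle zero = zero , z≤n , refl
  periodic j l cycle (suc t) with periodic j l cycle t
  ... | b , b≤j , eq with m≤n⇒m<n∨m≡n b≤j
  ...   | inj₁ b<j  = suc b , b<j , cong (next F) eq
  ...   | inj₂ refl = zero , z≤n , trans (cong (next F) eq) cycle

  stageFail⇒repeatFail : ∀ C fuel {l'} → first C ≡ just l' → runStage F C fuel ≡ fail →
    repeatLoop F fuel l' l' ≡ fail
  stageFail⇒repeatFail C fuel first≡ fails with first C
  stageFail⇒repeatFail C fuel refl fails | just _ = fails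

  failure⇒orbitReachesCompl : ∀ C fuel l' → first C ≡ just l' → runStage F C fuel ≡ fail →
    ∀ {x} → OnOrbit l' x → ReachesCompl x
  failure⇒orbitReachesCompl C fuel l' first≡ fails (t , reach)
    with repeatFail⇒cycle fuel l' l' (stageFail⇒repeatFail C fuel first≡ fails)
  ... | j , cycle , reaching with periodic j l' cycle t
  ...   | b , b≤j , eq = subst ReachesCompl (trans (sym eq) reach) (reaching b b≤j)

  orbit-compl : ∀ {l x} → (∀ {y} → OnOrbit l y → ReachesCompl y) →
    OnOrbit l x → OnOrbit l (compl x)
  orbit-compl {l} reaches (t , at-x) with reaches (t , at-x)
  ... | s , at-compl = s + t , trans (sym (next^-+ s t l)) (trans (cong (next^ F s) at-x) at-compl)

  orbit-cycSucc : ∀ {l c x} → Unique (concat F) → (∀ {y} → OnOrbit l y → ReachesCompl y) →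
    c ∈ F → x ∈ c → OnOrbit l x → OnOrbit l (cycSucc c x)
  orbit-cycSucc u reaches c∈F x∈c on-x with orbit-compl reaches on-x
  ... | t , at-compl = suc t , trans (cong (next F) at-compl) (next-compl u c∈F x∈c)

mainTheorem10 : (F : CNF) → Unique (concat F) → (i : Fin (length F)) →
    AlgorithmFailsAt F i → (l' : Literal) → first (lookup F i) ≡ just l' →
    (t : ℕ) (l : Literal) → next^ F t l' ≡ l →
    (l'' : Literal) → Any (λ c → l ∈ c × l'' ∈ c) F →
    ∃ λ t' → next^ F t' l' ≡ l''
mainTheorem10 F u i (_ , fuel , fails) l' first≡ t l at-l l'' shared
  with find shared
... | c , c∈F , l∈c , l''∈c = covers l∈c l''∈c (t , at-l)
  where
  open Dynamics F
  reaches : ∀ {y} → OnOrbit l' y → ReachesCompl y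
  reaches = failure⇒orbitReachesCompl (lookup F i) fuel l' first≡ fails
  open CyclicClosure c (OnOrbit l') (orbit-cycSucc u reaches c∈F)
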